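{- Let $\mathbb{C}$ be a process calculus. (1) If for every context $C$, every invisible process $I$ and every process $P$ of $\mathbb{C}$ it holds that $C[I]\lesssim_\omega C[P]$, then $\mathbb{C}$ is strongly replacement free. (2) If for every context $C$, every closed invisible process $I$ and every process $P$ of $\mathbb{C}$ it holds that $C[I]\lesssim_\omega C[P]$, then $\mathbb{C}$ is replacement free.
   Context: A process calculus has processes, free names $\mathrm{fn}(P)$ ($P$ closed iff $\mathrm{fn}(P)=\emptyset$), 1-hole contexts $C$ with hole filling $C[P]$, and a labelled transition semantics with visible actions and the invisible action $\tau$. $\Rightarrow$ is the reflexive-transitive closure of $\xrightarrow{\tau}$; $\stackrel{\hat\mu}{\Rightarrow}$ is $\Rightarrow$ if $\mu=\tau$ and $\Rightarrow\xrightarrow{\mu}\Rightarrow$ otherwise. $P\Downarrow$ iff $P\Rightarrow\xrightarrow{\alpha}\Rightarrow P'$ for some visible $\alpha$ and $P'$; $P$ is invisible iff not $P\Downarrow$. Relations $\lesssim_k$: $\lesssim_0$ is the universal relation on processes; for $1\le k<\omega$, $Q\lesssim_k P$ iff whenever $Q\xrightarrow{\mu}Q'$ there is $P'$ with $P\stackrel{\hat\mu}{\Rightarrow}P'$ and $Q'\lesssim_{k-1}P'$; $Q\lesssim_\omega P$ iff $Q\lesssim_k P$ for all $k<\omega$. The calculus is strongly replacement free if for every context $C$, invisible $I$ and process $P$, $C[I]\Downarrow$ implies $C[P]\Downarrow$; it is replacement free if this holds for every context $C$, closed invisible $I$ and process $P$. -}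

module Defs where

open import Level using (Level; _⊔_; suc)
open import Data.Nat using (ℕ; zero) renaming (suc to 1+)
open import Data.Product using (Σ; ∃; _×_; _,_)
open import Data.Empty using (⊥)
open import Data.Sum using (_⊎_)
open import Data.Unit.Polymorphic using (⊤)
open import Relation.Binary.PropositionalEquality using (_≡_)
open import Relation.Nullary using (¬_)
open import Relation.Binary.Construct.Closure.ReflexiveTransitive using (Star)

record ProcessCalculus (ℓ : Level) : Set (suc ℓ) where
  field
    Proc    : Set ℓ
    Name    : Set ℓ
    _∈fn_   : Name → Proc → Set ℓ
    Context : Set ℓ
    _[_]    : Context → Proc → Proc
    Act     : Set ℓ
    τ       : Act
    _⟶⟨_⟩_  : Proc → Act → Proc → Set ℓ

  Visible : Act → Set ℓ
  Visible α = ¬ (α ≡ τ)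

  Closed : Proc → Set ℓ
  Closed P = ∀ a → ¬ (a ∈fn P)

  _⟹_ : Proc → Proc → Set ℓ
  _⟹_ = Star (λ P Q → P ⟶⟨ τ ⟩ Q)

  _⟹̂⟨_⟩_ : Proc → Act → Proc → Set ℓ
  P ⟹̂⟨ μ ⟩ P' = (μ ≡ τ × P ⟹ P')
               ⊎ (¬ (μ ≡ τ) × ∃ λ Q → ∃ λ Q' → P ⟹ Q × Q ⟶⟨ μ ⟩ Q' × Q' ⟹ P')

  _⇓ : Proc → Set ℓ
  P ⇓ = ∃ λ α → Visible α × ∃ λ Q → ∃ λ Q' → ∃ λ P' →
          P ⟹ Q × Q ⟶⟨ α ⟩ Q' × Q' ⟹ P'

  Invisible : Proc → Set ℓ
  Invisible P = ¬ (P ⇓)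

  _≲[_]_ : Proc → ℕ → Proc → Set ℓ
  Q ≲[ zero ] P = ⊤
  Q ≲[ 1+ k ] P = ∀ μ Q' → Q ⟶⟨ μ ⟩ Q' → ∃ λ P' → P ⟹̂⟨ μ ⟩ P' × Q' ≲[ k ] P'

  _≲ω_ : Proc → Proc → Set ℓ
  Q ≲ω P = ∀ k → Q ≲[ k ] P

  StronglyReplacementFree : Set ℓ
  StronglyReplacementFree =
    ∀ (C : Context) (I P : Proc) → Invisible I → (C [ I ]) ⇓ → (C [ P ]) ⇓

  ReplacementFree : Set ℓ
  ReplacementFree =
    ∀ (C : Context) (I P : Proc) → Closed I → Invisible I → (C [ I ]) ⇓ → (C [ P ]) ⇓

-- A τ-path of length n from Q is matched, step by step, by a τ-path from P
-- using up n levels of the stratification; one further level matches the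
-- visible action.  Since ≲ω provides every level, Q⇓ transfers to P⇓, so
-- C[I] ≲ω C[P] turns C[I]⇓ into C[P]⇓.
module Submission where

open import Defs
open import Level using (Level)
open import Data.Nat using (ℕ; _+_) renaming (suc to 1+)
open import Data.Product using (_×_; _,_; ∃)
open import Data.Sum using (inj₁; inj₂)
open import Data.Empty using (⊥-elim)
open import Relation.Binary.PropositionalEquality using (refl)
open import Relation.Binary.Construct.Closure.ReflexiveTransitive using (ε; _◅_; _◅◅_)

module _ {ℓ : Level} (𝐂 : ProcessCalculus ℓ) where
  open ProcessCalculus 𝐂

  length : ∀ {Q Q'} → Q ⟹ Q' → ℕ
  length ε       = 0
  length (_ ◅ s) = 1+ (length s)

  ≲-τ-step : ∀ {k Q Q' P} → Q ≲[ 1+ k ] P → Q ⟶⟨ τ ⟩ Q' →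
             ∃ λ P' → P ⟹ P' × Q' ≲[ k ] P'
  ≲-τ-step sim t with sim τ _ t
  ... | P' , inj₁ (_ , P⟹P') , Q'≲P' = P' , P⟹P' , Q'≲P'
  ... | _  , inj₂ (τ≢τ , _)  , _     = ⊥-elim (τ≢τ refl)

  ≲-⟹ : ∀ {k Q Q' P} (s : Q ⟹ Q') → Q ≲[ length s + k ] P →
        ∃ λ P' → P ⟹ P' × Q' ≲[ k ] P'
  ≲-⟹ ε       sim = _ , ε , sim
  ≲-⟹ (t ◅ s) sim with ≲-τ-step sim t
  ... | P₁ , P⟹P₁ , Q₁≲P₁ with ≲-⟹ s Q₁≲P₁
  ...   | P' , P₁⟹P' , Q'≲P' = P' , P⟹P₁ ◅◅ P₁⟹P' , Q'≲P'

  ≲-visible-step-⇓ : ∀ {k Q Q' P α} → Visible α → Q ≲[ 1+ k ] P →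
                     Q ⟶⟨ α ⟩ Q' → P ⇓
  ≲-visible-step-⇓ {α = α} vis sim t with sim α _ t
  ... | _  , inj₁ (α≡τ , _) , _ = ⊥-elim (vis α≡τ)
  ... | P' , inj₂ (_ , R , R' , P⟹R , R⟶R' , R'⟹P') , _ =
    α , vis , R , R' , P' , P⟹R , R⟶R' , R'⟹P'

  ≲ω-preserves-⇓ : ∀ {Q P} → Q ≲ω P → Q ⇓ → P ⇓
  ≲ω-preserves-⇓ sim (α , vis , Q₁ , Q₂ , _ , Q⟹Q₁ , Q₁⟶Q₂ , _)
    with ≲-⟹ {k = 1} Q⟹Q₁ (sim (length Q⟹Q₁ + 1))
  ... | P₁ , P⟹P₁ , Q₁≲P₁
    with ≲-visible-step-⇓ vis Q₁≲P₁ Q₁⟶Q₂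
  ... | β , visβ , R , R' , P' , P₁⟹R , R⟶R' , R'⟹P' =
    β , visβ , R , R' , P' , P⟹P₁ ◅◅ P₁⟹R , R⟶R' , R'⟹P'

proposition3p2 : ∀ {ℓ : Level} (𝐂 : ProcessCalculus ℓ) →
    let open ProcessCalculus 𝐂 in
    ((∀ (C : Context) (I P : Proc) → Invisible I → (C [ I ]) ≲ω (C [ P ])) → StronglyReplacementFree)
    × ((∀ (C : Context) (I P : Proc) → Closed I → Invisible I → (C [ I ]) ≲ω (C [ P ])) → ReplacementFree)
proposition3p2 𝐂 =
    (λ C[I]≲C[P] C I P invisible → ≲ω-preserves-⇓ 𝐂 (C[I]≲C[P] C I P invisible))
  , (λ C[I]≲C[P] C I P closed invisible → ≲ω-preserves-⇓ 𝐂 (C[I]≲C[P] C I P closed invisible))
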